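{- Blocking type $(P_1P_1,P_2)$ is not possible for a correct translation and $k=2$.
   Context: SYNCSIMPLE: subprocesses $U ::= \checkmark \mid 0 \mid\ !U \mid\ ?U$; processes are parallel compositions (multisets) of subprocesses; reduction $!U_1 \mid ?U_2 \mid P \to U_1 \mid U_2 \mid P$; successful = has a parallel component $\checkmark$; may-convergent = reduces to a successful process; must-convergent = every reduct is may-convergent. LOCKSIMPLE$_{2,IS}$: two locks, each full ($\blacksquare$) or empty ($\Box$), initial store $IS$; subprocesses $U ::= 0 \mid \checkmark \mid P_iU \mid T_iU$ ($i\in\{1,2\}$); $P_i$ on empty lock $i$ fills it, on a full lock blocks; $T_i$ never blocks and empties lock $i$. Convergence evaluated from $(P,IS)$. Translations $\tau$: SYNCSIMPLE $\to$ LOCKSIMPLE$_{2,IS}$ are compositional ($\tau(0)=0$, $\tau(\checkmark)=\checkmark$, $\tau$ commutes with parallel composition, $\tau(!U)=\tau(!)\tau(U)$, $\tau(?U)=\tau(?)\tau(U)$); correct = preserve and reflect may- and must-convergence. Blocking types of a sequence $S$ executed alone from $IS$: type $P_iP_i$ if $S$ has a prefix $R_1P_iR_2P_i$ with $R_2$ free of $P_i,T_i$ and execution deadlocks exactly before the last $P_i$; type $P_i$ if $S$ has a prefix $R_1P_i$ with $R_1$ free of $P_i,T_i$ and execution deadlocks exactly before this $P_i$. $\tau$ has blocking type $(W_1,W_2)$ if $W_1$ is the type of $\tau(!)$ and $W_2$ that of $\tau(?)$. -}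

module Defs where

open import Data.Nat using (ℕ)
open import Data.Bool using (Bool; true; false)
open import Data.Fin using (Fin; zero; suc; _≟_)
open import Data.List using (List; []; _∷_; _++_; concatMap; map)
open import Data.List.Membership.Propositional using (_∈_)
open import Data.List.Relation.Binary.Permutation.Propositional using (_↭_)
open import Data.List.Relation.Unary.All using (All)
open import Data.Maybe using (Maybe; just; nothing; _>>=_)
open import Data.Product using (Σ; ∃; ∃-syntax; _×_; _,_)
open import Relation.Binary.PropositionalEquality using (_≡_; _≢_)
open import Relation.Nullary using (¬_; yes; no)
open import Relation.Binary.Construct.Closure.ReflexiveTransitive using (Star)
open import Function.Bundles using (_⇔_)

data End : Set where
  stop : End
  tick : End

data SyncAct : Set where
  snd : SyncAct
  rcv : SyncAct

record SSub : Set where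
  constructor _▹_
  field
    acts : List SyncAct
    end  : End

-- processes = multisets of subprocesses (lists up to permutation)
SProc : Set
SProc = List SSub

data _⟶S_ : SProc → SProc → Set where
  sync : ∀ {P Q} (U₁ U₂ : List SyncAct) (e₁ e₂ : End) (R : SProc) →
         P ↭ ((snd ∷ U₁) ▹ e₁) ∷ ((rcv ∷ U₂) ▹ e₂) ∷ R →
         Q ≡ (U₁ ▹ e₁) ∷ (U₂ ▹ e₂) ∷ R →
         P ⟶S Q

_⟶S*_ : SProc → SProc → Set
_⟶S*_ = Star _⟶S_

SSuccessful : SProc → Set
SSuccessful P = ([] ▹ tick) ∈ P

SMayConv : SProc → Set
SMayConv P = ∃[ Q ] (P ⟶S* Q × SSuccessful Q)

SMustConv : SProc → Set
SMustConv P = ∀ Q → P ⟶S* Q → SMayConv Q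

Lock : Set
Lock = Fin 2

lock₁ lock₂ : Lock
lock₁ = zero
lock₂ = suc zero

data LockAct : Set where
  P : Lock → LockAct
  T : Lock → LockAct

-- store: true = full (■), false = empty (□)
Store : Set
Store = Lock → Bool

update : Store → Lock → Bool → Store
update s i b j with i ≟ j
... | yes _ = b
... | no  _ = s j

-- one action on the store; nothing = blocked
stepAct : LockAct → Store → Maybe Store
stepAct (P i) s with s i
... | true  = nothing
... | false = just (update s i true)
stepAct (T i) s = just (update s i false)

record LSub : Set where
  constructor _▸_
  field
    acts : List LockAct
    end  : End

LProc : Set
LProc = List LSub

Config : Set
Config = LProc × Store

data _⟶L_ : Config → Config → Set where
  step : ∀ {P′ Q s s′} (a : LockAct) (U : List LockAct) (e : End) (R : LProc) →
         P′ ↭ ((a ∷ U) ▸ e) ∷ R →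
         stepAct a s ≡ just s′ →
         Q ≡ (U ▸ e) ∷ R →
         (P′ , s) ⟶L (Q , s′)

_⟶L*_ : Config → Config → Set
_⟶L*_ = Star _⟶L_

LSuccessful : Config → Set
LSuccessful (P′ , _) = ([] ▸ tick) ∈ P′

LMayConv : Config → Set
LMayConv c = ∃[ d ] (c ⟶L* d × LSuccessful d)

LMustConv : Config → Set
LMustConv c = ∀ d → c ⟶L* d → LMayConv d

-- Compositional translations: determined by τ(!) and τ(?)
record Translation : Set where
  constructor mkTr
  field
    τ! : List LockAct
    τ? : List LockAct

module _ (τ : Translation) where
  open Translation τ

  τAct : SyncAct → List LockAct
  τAct snd = τ!
  τAct rcv = τ?

  τSub : SSub → LSub
  τSub (as ▹ e) = concatMap τAct as ▸ e

  τProc : SProc → LProc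
  τProc = map τSub

Correct : Store → Translation → Set
Correct IS τ = ∀ (P₀ : SProc) →
  (SMayConv P₀ ⇔ LMayConv (τProc τ P₀ , IS)) ×
  (SMustConv P₀ ⇔ LMustConv (τProc τ P₀ , IS))

exec : Store → List LockAct → Maybe Store
exec s []       = just s
exec s (a ∷ as) = stepAct a s >>= λ s′ → exec s′ as

FreeOf : Lock → List LockAct → Set
FreeOf i = All (λ a → a ≢ P i × a ≢ T i)

TypePP : Store → Lock → List LockAct → Set
TypePP IS i S = ∃[ R₁ ] ∃[ R₂ ] ∃[ rest ] ∃[ s ]
  ( S ≡ R₁ ++ P i ∷ R₂ ++ P i ∷ rest
  × FreeOf i R₂
  × exec IS (R₁ ++ P i ∷ R₂) ≡ just s
  × s i ≡ true )

TypeP : Store → Lock → List LockAct → Set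
TypeP IS i S = ∃[ R₁ ] ∃[ rest ] ∃[ s ]
  ( S ≡ R₁ ++ P i ∷ rest
  × FreeOf i R₁
  × exec IS R₁ ≡ just s
  × s i ≡ true )

HasBlockingType : Store → Translation → (List LockAct → Set) → (List LockAct → Set) → Set
HasBlockingType IS τ W₁ W₂ = W₁ (Translation.τ! τ) × W₂ (Translation.τ? τ)

-- Because τ(?) has blocking type P₂, lock 2 is initially full, so every store in which lock 1 is
-- empty has no more full locks than the initial one; running the prefix R₁P₁R₂ of τ(!) from such
-- a store still succeeds and leaves lock 1 full. In the translation of  ?0 | !✓ | … | !✓  first
-- run one sender up to its blocking P₁, then the receiver: lock 1 stays full, so the receiver's
-- P₁'s block, and each of its T₁'s is answered by running a fresh sender up to its blocking P₁.
-- With more senders than τ(?) has T₁'s, everything ends deadlocked without ✓, although the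
-- source process is must-convergent.
module Submission where

open import Defs
open import Data.Bool using (true; false)
open import Data.Fin using (zero; suc; _≟_)
open import Data.Nat using (ℕ; suc)
open import Data.List using (List; []; _∷_; _++_; replicate)
open import Data.List.Properties using (++-assoc; ++-identityʳ; map-replicate)
open import Data.List.Relation.Unary.All as All using (All; []; _∷_)
open import Data.List.Relation.Unary.All.Properties using (++⁺; replicate⁺)
open import Data.List.Relation.Unary.Any using (here; there)
open import Data.List.Relation.Binary.Permutation.Propositional
  using (_↭_; refl; prep; swap; ↭-trans; ↭-sym)
open import Data.List.Relation.Binary.Permutation.Propositional.Properties
  using (∈-resp-↭; All-resp-↭; shift)
open import Data.Maybe using (just; nothing)
open import Data.Product using (∃-syntax; _×_; _,_; proj₂)
open import Data.Sum using (_⊎_; inj₁; inj₂)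
open import Relation.Binary.PropositionalEquality using (_≡_; _≢_; refl; sym; trans; cong; cong₂; subst)
open import Relation.Binary.Construct.Closure.ReflexiveTransitive using (ε; _◅_; _◅◅_)
open import Relation.Nullary using (¬_; yes; no; contradiction)
open import Function.Bundles using (Equivalence)

update-same : ∀ s i b → update s i b i ≡ b
update-same s i b with i ≟ i
... | yes _  = refl
... | no i≢i = contradiction refl i≢i

update-other : ∀ s {i j} b → i ≢ j → update s i b j ≡ s j
update-other s {i} {j} b i≢j with i ≟ j
... | yes i≡j = contradiction i≡j i≢j
... | no _    = refl

_⊑_ : Store → Store → Set
u ⊑ s = ∀ i → u i ≡ true → s i ≡ true

update-⊑ : ∀ {u s} i b → u ⊑ s → update u i b ⊑ update s i b
update-⊑ {u} {s} i b u⊑s j with i ≟ j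
... | yes _ = λ ub → ub
... | no _  = u⊑s j

stepAct-⊑ : ∀ {u s s′} a → u ⊑ s → stepAct a s ≡ just s′ →
  ∃[ u′ ] (stepAct a u ≡ just u′ × u′ ⊑ s′)
stepAct-⊑ (T i) u⊑s refl = _ , refl , update-⊑ i false u⊑s
stepAct-⊑ {u} {s} (P i) u⊑s ok with s i in si | u i in ui
stepAct-⊑ (P i) u⊑s () | true  | _
... | false | true  = contradiction (trans (sym (u⊑s i ui)) si) λ ()
stepAct-⊑ (P i) u⊑s refl | false | false = _ , refl , update-⊑ i true u⊑s

exec-⊑ : ∀ {u s t} w → u ⊑ s → exec s w ≡ just t → ∃[ u′ ] (exec u w ≡ just u′ × u′ ⊑ t)
exec-⊑ [] u⊑s refl = _ , refl , u⊑s
exec-⊑ {s = s} (a ∷ w) u⊑s ok with stepAct a s in sa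
... | just s′ with stepAct-⊑ a u⊑s sa
...   | u′ , ua , u′⊑s′ rewrite ua = exec-⊑ w u′⊑s′ ok

stepAct-blocks : ∀ {s} i → s i ≡ true → stepAct (P i) s ≡ nothing
stepAct-blocks i si rewrite si = refl

stepAct-fills : ∀ {s s′} i → stepAct (P i) s ≡ just s′ → s′ i ≡ true
stepAct-fills {s} i ok with s i
stepAct-fills {s} i refl | false = update-same s i true

stepAct-keeps-full : ∀ {s s′ j} a → a ≢ T j → s j ≡ true → stepAct a s ≡ just s′ → s′ j ≡ true
stepAct-keeps-full {j = j} (T k) a≢Tj sj refl with k ≟ j
... | yes refl = contradiction refl a≢Tj
... | no _     = sj
stepAct-keeps-full {s} {j = j} (P k) _ sj ok with s k
stepAct-keeps-full {s} {j = j} (P k) _ sj refl | false with k ≟ j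
... | yes _ = refl
... | no _  = sj

stepAct-untouched : ∀ {s s′ j} a → a ≢ P j × a ≢ T j → stepAct a s ≡ just s′ → s′ j ≡ s j
stepAct-untouched {s} (T k) (_ , a≢Tj) refl = update-other s false λ k≡j → a≢Tj (cong T k≡j)
stepAct-untouched {s} (P k) (a≢Pj , _) ok with s k
stepAct-untouched {s} (P k) (a≢Pj , _) refl | false = update-other s true λ k≡j → a≢Pj (cong P k≡j)

exec-FreeOf : ∀ {s t i} w → FreeOf i w → exec s w ≡ just t → t i ≡ s i
exec-FreeOf [] [] refl = refl
exec-FreeOf {s} (a ∷ w) (a-free ∷ w-free) ok with stepAct a s in sa
... | just s′ = trans (exec-FreeOf w w-free ok) (stepAct-untouched a a-free sa)

exec-++⁻ : ∀ {s t} u v → exec s (u ++ v) ≡ just t → ∃[ m ] (exec s u ≡ just m × exec m v ≡ just t)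
exec-++⁻ [] v ok = _ , refl , ok
exec-++⁻ {s} (a ∷ u) v ok with stepAct a s
... | just _ = exec-++⁻ u v ok

TypeP⇒full : ∀ {IS i S} → TypeP IS i S → IS i ≡ true
TypeP⇒full (R₁ , _ , _ , _ , R₁-free , ok , full) = trans (sym (exec-FreeOf R₁ R₁-free ok)) full

LeavesFull : Store → Lock → List LockAct → Set
LeavesFull IS i pre = ∀ u → u ⊑ IS → ∃[ t ] (exec u pre ≡ just t × t i ≡ true)

TypePP⇒LeavesFull : ∀ {IS i S} → TypePP IS i S →
  ∃[ pre ] ∃[ post ] (S ≡ pre ++ P i ∷ post × LeavesFull IS i pre)
TypePP⇒LeavesFull {IS} {i} (R₁ , R₂ , post , _ , refl , R₂-free , ok , _) =
  R₁ ++ P i ∷ R₂ , post , sym (++-assoc R₁ (P i ∷ R₂) (P i ∷ post)) , leavesFull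
  where
  fills : ∀ {u t} → exec u (R₁ ++ P i ∷ R₂) ≡ just t → t i ≡ true
  fills ok′ with exec-++⁻ R₁ (P i ∷ R₂) ok′
  ... | m , _ , ok″ with stepAct (P i) m in pi
  ...   | just _ = trans (exec-FreeOf R₂ R₂-free ok″) (stepAct-fills i pi)

  leavesFull : LeavesFull IS i (R₁ ++ P i ∷ R₂)
  leavesFull u u⊑IS with exec-⊑ (R₁ ++ P i ∷ R₂) u⊑IS ok
  ... | t , ok′ , _ = t , ok′ , fills ok′

_↠_ : Config → Config → Set
c ↠ (L , s) = ∃[ M ] (c ⟶L* (M , s) × M ↭ L)

⟶L*-permˡ : ∀ {L M s N t} → M ↭ L → (L , s) ⟶L* (N , t) → (M , s) ↠ (N , t)
⟶L*-permˡ {M = M} M↭L ε = M , ε , M↭L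
⟶L*-permˡ M↭L (step a U e R p ok refl ◅ rest) = _ , step a U e R (↭-trans M↭L p) ok refl ◅ rest , refl

↠-perm : ∀ {L M s} → M ↭ L → (M , s) ↠ (L , s)
↠-perm M↭L = _ , ε , M↭L

↠-refl : ∀ {c} → c ↠ c
↠-refl = ↠-perm refl

↠-permˡ : ∀ {L M s N t} → M ↭ L → (L , s) ↠ (N , t) → (M , s) ↠ (N , t)
↠-permˡ M↭L (N , steps , N↭) with ⟶L*-permˡ M↭L steps
... | N′ , steps′ , N′↭N = N′ , steps′ , ↭-trans N′↭N N↭

↠-trans : ∀ {c L s N t} → c ↠ (L , s) → (L , s) ↠ (N , t) → c ↠ (N , t)
↠-trans (M , steps , M↭L) reach with ↠-permˡ M↭L reach
... | N , steps′ , N↭ = N , steps ◅◅ steps′ , N↭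

↠-step : ∀ {a U e R s s′} → stepAct a s ≡ just s′ → (((a ∷ U) ▸ e) ∷ R , s) ↠ ((U ▸ e) ∷ R , s′)
↠-step ok = _ , step _ _ _ _ refl ok refl ◅ ε , refl

↠-exec : ∀ {e R s t} w v → exec s w ≡ just t → (((w ++ v) ▸ e) ∷ R , s) ↠ ((v ▸ e) ∷ R , t)
↠-exec [] v refl = ↠-refl
↠-exec {s = s} (a ∷ w) v ok with stepAct a s in sa
... | just _ = ↠-trans (↠-step sa) (↠-exec w v ok)

data Stuck (s : Store) : LSub → Set where
  finished : Stuck s ([] ▸ stop)
  blocked  : ∀ {a U e} → stepAct a s ≡ nothing → Stuck s ((a ∷ U) ▸ e)

Deadlocked : Config → Set
Deadlocked (L , s) = All (Stuck s) L

deadlocked⇒¬mayConv : ∀ {c} → Deadlocked c → ¬ LMayConv c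
deadlocked⇒¬mayConv stuck (_ , ε , success) with All.lookup stuck success
... | ()
deadlocked⇒¬mayConv stuck (_ , step a U e R p ok refl ◅ _ , _)
  with All.lookup stuck (∈-resp-↭ (↭-sym p) (here refl))
... | blocked ko = contradiction (trans (sym ko) ok) λ ()

↠-deadlocked⇒¬mustConv : ∀ {c d} → c ↠ d → Deadlocked d → ¬ LMustConv c
↠-deadlocked⇒¬mustConv (M , steps , M↭L) stuck must =
  deadlocked⇒¬mayConv (All-resp-↭ (↭-sym M↭L) stuck) (must _ steps)

oneReceiver : ℕ → SProc
oneReceiver j = ((rcv ∷ []) ▹ stop) ∷ replicate (suc j) ((snd ∷ []) ▹ tick)

oneReceiver-mustConv : ∀ j → SMustConv (oneReceiver j)
oneReceiver-mustConv j Q steps = mayConv (preserved* steps (inj₁ refl))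
  where
  Invariant : SProc → Set
  Invariant Q = Q ↭ oneReceiver j ⊎ SSuccessful Q

  mayConv : ∀ {Q} → Invariant Q → SMayConv Q
  mayConv (inj₁ Q↭) = _ , sync [] [] tick stop _ (↭-trans Q↭ (swap _ _ refl)) refl ◅ ε , here refl
  mayConv (inj₂ success) = _ , ε , success

  preserved : ∀ {Q Q′} → Q ⟶S Q′ → Invariant Q → Invariant Q′
  preserved (sync _ _ _ _ _ p refl) (inj₂ success) with ∈-resp-↭ p success
  ... | there (there success′) = inj₂ (there (there success′))
  preserved (sync _ _ _ _ _ p refl) (inj₁ Q↭) with ∈-resp-↭ (↭-trans (↭-sym p) Q↭) (here refl)
  ... | there sender with All.lookup (replicate⁺ {P = _≡ (snd ∷ []) ▹ tick} (suc j) refl) sender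
  ...   | refl = inj₂ (here refl)

  preserved* : ∀ {Q Q′} → Q ⟶S* Q′ → Invariant Q → Invariant Q′
  preserved* ε inv = inv
  preserved* (first ◅ rest) inv = preserved* rest (preserved first inv)

module Starvation {IS : Store} {i : Lock} (othersFull : ∀ k → k ≢ i → IS k ≡ true)
                  (pre post : List LockAct) (leavesFull : LeavesFull IS i pre) where

  sender : LSub
  sender = (pre ++ P i ∷ post) ▸ tick

  waitingSender : LSub
  waitingSender = (P i ∷ post) ▸ tick

  data WaitsOnLock : LSub → Set where
    waiting : ∀ U e → WaitsOnLock ((P i ∷ U) ▸ e)

  waiting⇒stuck : ∀ {s u} → s i ≡ true → WaitsOnLock u → Stuck s u
  waiting⇒stuck si (waiting _ _) = blocked (stepAct-blocks i si)

  emptied⊑IS : ∀ {u} → u i ≡ false → u ⊑ IS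
  emptied⊑IS ui k uk with k ≟ i
  ... | yes refl = contradiction (trans (sym uk) ui) λ ()
  ... | no k≢i   = othersFull k k≢i

  runSender : ∀ {u} → u ⊑ IS → ∃[ t ] (t i ≡ true × ∀ L → (sender ∷ L , u) ↠ (waitingSender ∷ L , t))
  runSender {u} u⊑IS with leavesFull u u⊑IS
  ... | t , ok , full = t , full , λ L → ↠-exec pre (P i ∷ post) ok

  starve : ∀ w {s} Q → s i ≡ true → All WaitsOnLock Q →
    ∃[ j ] ∃[ d ] (((w ▸ stop) ∷ Q ++ replicate j sender , s) ↠ d × Deadlocked d)
  starve [] Q si waits = 0 , _ , ↠-refl , finished ∷ ++⁺ (All.map (waiting⇒stuck si) waits) []
  starve (P k ∷ w) {s} Q si waits with stepAct (P k) s in pk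
  ... | nothing = 0 , _ , ↠-refl , blocked pk ∷ ++⁺ (All.map (waiting⇒stuck si) waits) []
  ... | just _ with starve w Q (stepAct-keeps-full (P k) (λ ()) si pk) waits
  ...   | j , d , reach , dead = j , d , ↠-trans (↠-step pk) reach , dead
  starve (T k ∷ w) Q si waits with k ≟ i
  ... | no k≢i with starve w Q (stepAct-keeps-full (T k) (λ { refl → k≢i refl }) si refl) waits
  ...   | j , d , reach , dead = j , d , ↠-trans (↠-step refl) reach , dead
  starve (T k ∷ w) {s} Q si waits | yes refl with runSender (emptied⊑IS (update-same s i false))
  ... | t , ti , run with starve w (waitingSender ∷ Q) ti (waiting _ _ ∷ waits)
  ...   | j , d , reach , dead =
    suc j , d ,
    ↠-trans (↠-step refl)
      (↠-permˡ senderFirst (↠-trans (run _) (↠-permˡ (swap _ _ refl) reach))) ,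
    dead
    where
    senderFirst : (w ▸ stop) ∷ Q ++ sender ∷ replicate j sender
                ↭ sender ∷ (w ▸ stop) ∷ Q ++ replicate j sender
    senderFirst = ↭-trans (prep _ (shift sender Q _)) (swap _ _ refl)

  noMustConv : ∀ w → ∃[ j ] ¬ LMustConv ((w ▸ stop) ∷ replicate (suc j) sender , IS)
  noMustConv w with runSender (λ _ full → full)
  ... | t , ti , run with starve w (waitingSender ∷ []) ti (waiting _ _ ∷ [])
  ...   | j , d , reach , dead = j , ↠-deadlocked⇒¬mustConv reach′ dead
    where
    reach′ : ((w ▸ stop) ∷ replicate (suc j) sender , IS) ↠ d
    reach′ = ↠-permˡ (swap _ _ refl) (↠-trans (run _) (↠-permˡ (swap _ _ refl) reach))

open Translation using (τ!; τ?)

τProc-oneReceiver : ∀ τ j {S} → τ! τ ≡ S →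
  τProc τ (oneReceiver j) ≡ (τ? τ ▸ stop) ∷ replicate (suc j) (S ▸ tick)
τProc-oneReceiver τ j τ!≡S =
  cong₂ _∷_ (cong (_▸ stop) (++-identityʳ (τ? τ)))
            (trans (map-replicate (τSub τ) (suc j) _)
                   (cong (λ S → replicate (suc j) (S ▸ tick)) (trans (++-identityʳ (τ! τ)) τ!≡S)))

typePP⇒¬mustConv : ∀ {IS i} τ → TypePP IS i (τ! τ) → (∀ k → k ≢ i → IS k ≡ true) →
  ∃[ j ] ¬ LMustConv (τProc τ (oneReceiver j) , IS)
typePP⇒¬mustConv {IS} τ pp othersFull with TypePP⇒LeavesFull pp
... | pre , post , τ!≡ , leavesFull with Starvation.noMustConv othersFull pre post leavesFull (τ? τ)
...   | j , ¬must = j , subst (λ L → ¬ LMustConv (L , IS)) (sym (τProc-oneReceiver τ j τ!≡)) ¬must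

lemma5p11 : ∀ (IS : Store) (τ : Translation) → Correct IS τ →
    ¬ HasBlockingType IS τ (TypePP IS lock₁) (TypeP IS lock₂)
lemma5p11 IS τ correct (τ!-type , τ?-type) =
  let j , ¬must = typePP⇒¬mustConv τ τ!-type othersFull
  in ¬must (Equivalence.to (proj₂ (correct (oneReceiver j))) (oneReceiver-mustConv j))
  where
  othersFull : ∀ k → k ≢ lock₁ → IS k ≡ true
  othersFull zero       k≢lock₁ = contradiction refl k≢lock₁
  othersFull (suc zero) _       = TypeP⇒full τ?-type
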